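{- Let $T_1,T_2$ be two trees on the same label set $\mathcal{X}$ and let $X\subseteq\mathcal{X}$. Then $T_1-X=T_2-X$ if and only if there is an LPR sequence $(x_1,x_2,\ldots,x_k)$ turning $T_1$ into $T_2$ such that $X=\{x_1,\ldots,x_k\}$.
   Context: All trees are rooted binary phylogenetic trees: rooted trees in which every non-leaf node has exactly two children, whose leaves are bijectively labeled by a finite label set $\mathcal{X}(T)$; two trees are equal if there is a label-preserving isomorphism between them. For $L\subseteq\mathcal{X}(T)$, $T-L$ is the tree obtained from $T$ by removing every leaf labeled by an element of $L$, contracting the resulting non-root vertices of degree two, and repeatedly deleting the root while it has degree one. Grafting a single leaf $\ell$ on an edge $e$ of a tree means subdividing $e$ and making the new degree-2 node the parent of $\ell$; grafting $\ell$ above a tree means creating a new root whose children are the old root and $\ell$. An LPR (leaf prune-and-regraft) move on a tree $T$ with label set $\mathcal{X}$ is a pair $(\ell,e)$ with $\ell\in\mathcal{X}$ and $e$ either an edge of $T-\{\ell\}$ or the symbol $\perp$; applying it means grafting $\ell$ on edge $e$ of $T-\{\ell\}$ if $e\neq\perp$, and above the root of $T-\{\ell\}$ if $e=\perp$. An LPR sequence $((\ell_1,e_1),\ldots,(\ell_k,e_k))$ is a tuple of LPR moves where each $(\ell_i,e_i)$ is an LPR move on the tree obtained after applying the first $i-1$ moves; it is also written $(\ell_1,\ldots,\ell_k)$ when the grafting locations need not be specified. It turns $T_1$ into $T_2$ if applying its moves in order to $T_1$ yields $T_2$. -}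

module Defs where

open import Data.List using (List; []; _∷_; [_]; _++_)
open import Data.Maybe using (Maybe; just; nothing; _>>=_)
import Data.Maybe as Maybe
open import Data.Product using (_×_; _,_)
open import Relation.Binary.Definitions using (DecidableEquality)
open import Relation.Nullary using (yes; no)
import Data.List.Membership.DecPropositional as DecMem

-- Rooted binary phylogenetic trees: leaves carry labels, every internal
-- node has exactly two children.  (Bijectivity of the labelling is imposed
-- as a hypothesis 'Unique (leaves T)' where needed.)
data Tree (A : Set) : Set where
  leaf : A → Tree A
  node : Tree A → Tree A → Tree A

leaves : {A : Set} → Tree A → List A
leaves (leaf a)   = a ∷ []
leaves (node l r) = leaves l ++ leaves r

-- Equality of trees = existence of a label-preserving isomorphism.
-- For rooted binary trees, an isomorphism is exactly a recursive choice,
-- at each internal node, of whether the two children are swapped.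
data _≅_ {A : Set} : Tree A → Tree A → Set where
  leaf≅ : ∀ {a} → leaf a ≅ leaf a
  node≅ : ∀ {l l′ r r′} → l ≅ l′ → r ≅ r′ → node l r ≅ node l′ r′
  swap≅ : ∀ {l l′ r r′} → l ≅ r′ → r ≅ l′ → node l r ≅ node l′ r′

-- Equality of possibly-empty trees (T - L may be the empty tree).
data _≅ᵐ_ {A : Set} : Maybe (Tree A) → Maybe (Tree A) → Set where
  nothing≅ : nothing ≅ᵐ nothing
  just≅    : ∀ {t u} → t ≅ u → just t ≅ᵐ just u

data Dir : Set where
  goL goR : Dir

-- Grafting location of an LPR move: either ⊥ (above the root), or an edge,
-- identified by its lower endpoint, a non-root node, addressed by a
-- non-empty path from the root.
data Pos : Set where
  aboveRoot : Pos
  onEdge    : Dir → List Dir → Pos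

-- Subdivide the edge above the node at the given path and hang ℓ there
-- (the empty path means: graft above the root of the given subtree).
-- Returns nothing if the path does not address a node.
graftAt : {A : Set} → A → List Dir → Tree A → Maybe (Tree A)
graftAt ℓ []         t          = just (node t (leaf ℓ))
graftAt ℓ (goL ∷ ds) (node l r) = Maybe.map (λ l′ → node l′ r) (graftAt ℓ ds l)
graftAt ℓ (goR ∷ ds) (node l r) = Maybe.map (λ r′ → node l r′) (graftAt ℓ ds r)
graftAt ℓ (_ ∷ _)    (leaf _)   = nothing

-- Grafting a leaf onto a possibly-empty tree.  Grafting above the empty
-- tree yields the single-leaf tree (convention).
graft : {A : Set} → A → Pos → Maybe (Tree A) → Maybe (Tree A)
graft ℓ aboveRoot     nothing  = just (leaf ℓ)
graft ℓ aboveRoot     (just t) = just (node t (leaf ℓ))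
graft ℓ (onEdge d ds) nothing  = nothing
graft ℓ (onEdge d ds) (just t) = graftAt ℓ (d ∷ ds) t

LPRMove : Set → Set
LPRMove A = A × Pos

module WithDecEq {A : Set} (_≟_ : DecidableEquality A) where
  open DecMem _≟_ using (_∈?_)

  -- T - L : delete leaves with labels in L, suppress degree-2 vertices,
  -- delete a degree-1 root.  'nothing' is the empty tree.
  removeLeaves : List A → Tree A → Maybe (Tree A)
  removeLeaves L (leaf a) with a ∈? L
  ... | yes _ = nothing
  ... | no _  = just (leaf a)
  removeLeaves L (node l r) with removeLeaves L l | removeLeaves L r
  ... | nothing | nothing = nothing
  ... | just x  | nothing = just x
  ... | nothing | just y  = just y
  ... | just x  | just y  = just (node x y)

  applyMove : Tree A → LPRMove A → Maybe (Tree A)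
  applyMove t (ℓ , p) with ℓ ∈? leaves t
  ... | yes _ = graft ℓ p (removeLeaves [ ℓ ] t)
  ... | no _  = nothing

  applySeq : Tree A → List (LPRMove A) → Maybe (Tree A)
  applySeq t []       = just t
  applySeq t (m ∷ ms) = applyMove t m >>= λ t′ → applySeq t′ ms

  TurnsInto : Tree A → List (LPRMove A) → Tree A → Set
  TurnsInto T₁ ms T₂ = applySeq T₁ ms ≅ᵐ just T₂

module Submission where

-- (⇐) Grafting a label ℓ ∈ X is invisible in T - X, so every move of a
-- label of X leaves T - X unchanged; and T - X respects isomorphism.
--
-- (⇒) Let D be X without repetitions.  Moving the labels of D above the
-- root one after the other turns Tᵢ into a "stack" over Tᵢ - D, so the two
-- stacks are isomorphic.  On trees with distinct labels every move can be
-- undone by a move of the same label, so T₂'s stacking can be reversed;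
-- LPR sequences transport along isomorphisms of their starting tree, so the
-- reversal also runs from T₁'s stack.  Stacking T₁ and then reversing moves
-- exactly the labels of D.

open import Defs
open import Data.List using (List; []; _∷_; [_]; _++_; map; deduplicate)
open import Data.List.Properties using (map-++; map-∘; map-id)
open import Data.List.Membership.Propositional using (_∈_; _∉_)
open import Data.List.Membership.Propositional.Properties using (∈-++⁺ˡ; ∈-++⁺ʳ; ∈-++⁻; ∈-deduplicate⁺; ∈-deduplicate⁻)
open import Data.List.Relation.Binary.Disjoint.Propositional using (Disjoint)
open import Data.List.Relation.Binary.Disjoint.Propositional.Properties using () renaming (sym to Disjoint-sym)
open import Data.List.Relation.Binary.Subset.Propositional using (_⊆_)
open import Data.List.Relation.Unary.All as All using ()
open import Data.List.Relation.Unary.All.Properties using (All¬⇒¬Any; ++⁻ˡ; ++⁻ʳ)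
open import Data.List.Relation.Unary.AllPairs using ([]; _∷_)
open import Data.List.Relation.Unary.Any using (here; there)
open import Data.List.Relation.Unary.Any.Properties using (singleton⁻)
open import Data.List.Relation.Unary.Unique.Propositional using (Unique)
open import Data.List.Relation.Unary.Unique.DecPropositional.Properties using (deduplicate-!)
open import Data.Empty using (⊥-elim)
open import Data.Maybe using (Maybe; just; nothing; _>>=_)
import Data.Maybe as Maybe
open import Data.Product using (Σ; _×_; _,_; proj₁; proj₂)
import Data.Product as Product
open import Data.Sum using (_⊎_; inj₁; inj₂; [_,_]′)
import Data.Sum as Sum
open import Data.Unit using (⊤; tt)
open import Function using (_∘_; id)
open import Function.Bundles using (_⇔_; mk⇔; Equivalence)
open import Relation.Binary.Definitions using (DecidableEquality)
open import Relation.Binary.PropositionalEquality using (_≡_; refl; sym; trans; cong; subst; subst₂; module ≡-Reasoning)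
open import Relation.Nullary using (yes; no)

module _ {A : Set} where

  ≅-refl : {t : Tree A} → t ≅ t
  ≅-refl {leaf a}   = leaf≅
  ≅-refl {node l r} = node≅ ≅-refl ≅-refl

  ≅-sym : {t u : Tree A} → t ≅ u → u ≅ t
  ≅-sym leaf≅       = leaf≅
  ≅-sym (node≅ p q) = node≅ (≅-sym p) (≅-sym q)
  ≅-sym (swap≅ p q) = swap≅ (≅-sym q) (≅-sym p)

  ≅-trans : {t u v : Tree A} → t ≅ u → u ≅ v → t ≅ v
  ≅-trans leaf≅       leaf≅         = leaf≅
  ≅-trans (node≅ p q) (node≅ p′ q′) = node≅ (≅-trans p p′) (≅-trans q q′)
  ≅-trans (node≅ p q) (swap≅ p′ q′) = swap≅ (≅-trans p p′) (≅-trans q q′)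
  ≅-trans (swap≅ p q) (node≅ p′ q′) = swap≅ (≅-trans p q′) (≅-trans q p′)
  ≅-trans (swap≅ p q) (swap≅ p′ q′) = node≅ (≅-trans p q′) (≅-trans q p′)

  ≅ᵐ-refl : {m : Maybe (Tree A)} → m ≅ᵐ m
  ≅ᵐ-refl {nothing} = nothing≅
  ≅ᵐ-refl {just t}  = just≅ ≅-refl

  ≅ᵐ-trans : {m n o : Maybe (Tree A)} → m ≅ᵐ n → n ≅ᵐ o → m ≅ᵐ o
  ≅ᵐ-trans nothing≅  nothing≅  = nothing≅
  ≅ᵐ-trans (just≅ p) (just≅ q) = just≅ (≅-trans p q)

  ≅ᵐ-just⁻ : (m : Maybe (Tree A)) {v : Tree A} → m ≅ᵐ just v →
             Σ (Tree A) λ u → m ≡ just u × u ≅ v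
  ≅ᵐ-just⁻ (just u) (just≅ u≅v) = u , refl , u≅v

  just-≅⁻ : {t u : Tree A} → just t ≅ᵐ just u → t ≅ u
  just-≅⁻ (just≅ t≅u) = t≅u

  ∈-≅ : {t u : Tree A} {a : A} → t ≅ u → a ∈ leaves t → a ∈ leaves u
  ∈-≅ leaf≅ a∈t = a∈t
  ∈-≅ {node l r} {node l′ r′} (node≅ p q) a∈t with ∈-++⁻ (leaves l) a∈t
  ... | inj₁ a∈l = ∈-++⁺ˡ (∈-≅ p a∈l)
  ... | inj₂ a∈r = ∈-++⁺ʳ (leaves l′) (∈-≅ q a∈r)
  ∈-≅ {node l r} {node l′ r′} (swap≅ p q) a∈t with ∈-++⁻ (leaves l) a∈t
  ... | inj₁ a∈l = ∈-++⁺ʳ (leaves l′) (∈-≅ p a∈l)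
  ... | inj₂ a∈r = ∈-++⁺ˡ (∈-≅ q a∈r)

  leavesᵐ : Maybe (Tree A) → List A
  leavesᵐ nothing  = []
  leavesᵐ (just t) = leaves t

  nodeᵐ : Maybe (Tree A) → Maybe (Tree A) → Maybe (Tree A)
  nodeᵐ nothing  nothing  = nothing
  nodeᵐ (just x) nothing  = just x
  nodeᵐ nothing  (just y) = just y
  nodeᵐ (just x) (just y) = just (node x y)

  nodeᵐ-nothingʳ : (m : Maybe (Tree A)) → nodeᵐ m nothing ≡ m
  nodeᵐ-nothingʳ nothing  = refl
  nodeᵐ-nothingʳ (just x) = refl

  nodeᵐ-nothingˡ : (m : Maybe (Tree A)) → nodeᵐ nothing m ≡ m
  nodeᵐ-nothingˡ nothing  = refl
  nodeᵐ-nothingˡ (just x) = refl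

  ∈-nodeᵐ⁻ : ∀ {a} m₁ m₂ → a ∈ leavesᵐ (nodeᵐ m₁ m₂) → a ∈ leavesᵐ m₁ ⊎ a ∈ leavesᵐ m₂
  ∈-nodeᵐ⁻ (just x) nothing  a∈ = inj₁ a∈
  ∈-nodeᵐ⁻ nothing  (just y) a∈ = inj₂ a∈
  ∈-nodeᵐ⁻ (just x) (just y) a∈ = ∈-++⁻ (leaves x) a∈

  ∈-nodeᵐ⁺ˡ : ∀ {a} m₁ m₂ → a ∈ leavesᵐ m₁ → a ∈ leavesᵐ (nodeᵐ m₁ m₂)
  ∈-nodeᵐ⁺ˡ (just x) nothing  a∈ = a∈
  ∈-nodeᵐ⁺ˡ (just x) (just y) a∈ = ∈-++⁺ˡ a∈

  ∈-nodeᵐ⁺ʳ : ∀ {a} m₁ m₂ → a ∈ leavesᵐ m₂ → a ∈ leavesᵐ (nodeᵐ m₁ m₂)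
  ∈-nodeᵐ⁺ʳ nothing  (just y) a∈ = a∈
  ∈-nodeᵐ⁺ʳ (just x) (just y) a∈ = ∈-++⁺ʳ (leaves x) a∈

  nodeᵐ-cong : ∀ {m₁ m₁′ m₂ m₂′} → m₁ ≅ᵐ m₁′ → m₂ ≅ᵐ m₂′ → nodeᵐ m₁ m₂ ≅ᵐ nodeᵐ m₁′ m₂′
  nodeᵐ-cong nothing≅  nothing≅  = nothing≅
  nodeᵐ-cong (just≅ p) nothing≅  = just≅ p
  nodeᵐ-cong nothing≅  (just≅ q) = just≅ q
  nodeᵐ-cong (just≅ p) (just≅ q) = just≅ (node≅ p q)

  nodeᵐ-swap : ∀ {m₁ m₁′ m₂ m₂′} → m₁ ≅ᵐ m₂′ → m₂ ≅ᵐ m₁′ → nodeᵐ m₁ m₂ ≅ᵐ nodeᵐ m₁′ m₂′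
  nodeᵐ-swap nothing≅  nothing≅  = nothing≅
  nodeᵐ-swap (just≅ p) nothing≅  = just≅ p
  nodeᵐ-swap nothing≅  (just≅ q) = just≅ q
  nodeᵐ-swap (just≅ p) (just≅ q) = just≅ (swap≅ p q)

  data Distinct : Tree A → Set where
    leaf : ∀ {a} → Distinct (leaf a)
    node : ∀ {l r} → Distinct l → Distinct r → Disjoint (leaves l) (leaves r) → Distinct (node l r)

  Distinctᵐ : Maybe (Tree A) → Set
  Distinctᵐ nothing  = ⊤
  Distinctᵐ (just t) = Distinct t

  Unique-++⁻ : ∀ xs {ys : List A} → Unique (xs ++ ys) → Unique xs × Unique ys × Disjoint xs ys
  Unique-++⁻ []       u-ys           = [] , u-ys , λ { (() , _) }
  Unique-++⁻ (x ∷ xs) {ys} (x∉ ∷ u) with Unique-++⁻ xs u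
  ... | u-xs , u-ys , xs#ys = ++⁻ˡ xs x∉ ∷ u-xs , u-ys , x∷xs#ys
    where
    x∷xs#ys : Disjoint (x ∷ xs) ys
    x∷xs#ys (here refl , v∈ys) = All.lookup (++⁻ʳ xs x∉) v∈ys refl
    x∷xs#ys (there v∈xs , v∈ys) = xs#ys (v∈xs , v∈ys)

  unique⇒distinct : (t : Tree A) → Unique (leaves t) → Distinct t
  unique⇒distinct (leaf a)   _ = leaf
  unique⇒distinct (node l r) u with Unique-++⁻ (leaves l) u
  ... | u-l , u-r , l#r = node (unique⇒distinct l u-l) (unique⇒distinct r u-r) l#r

  nodeᵐ-distinct : ∀ {m₁ m₂} → Distinctᵐ m₁ → Distinctᵐ m₂ →
                   Disjoint (leavesᵐ m₁) (leavesᵐ m₂) → Distinctᵐ (nodeᵐ m₁ m₂)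
  nodeᵐ-distinct {nothing} {nothing} _  _  _   = tt
  nodeᵐ-distinct {just _}  {nothing} d₁ _  _   = d₁
  nodeᵐ-distinct {nothing} {just _}  _  d₂ _   = d₂
  nodeᵐ-distinct {just _}  {just _}  d₁ d₂ 1#2 = node d₁ d₂ 1#2

  graftAt-goL⁻ : ∀ ℓ ds l r {u} → graftAt ℓ (goL ∷ ds) (node l r) ≡ just u →
                 Σ (Tree A) λ l′ → graftAt ℓ ds l ≡ just l′ × u ≡ node l′ r
  graftAt-goL⁻ ℓ ds l r grafted with graftAt ℓ ds l
  graftAt-goL⁻ ℓ ds l r refl | just l′ = l′ , refl , refl

  graftAt-goR⁻ : ∀ ℓ ds l r {u} → graftAt ℓ (goR ∷ ds) (node l r) ≡ just u →
                 Σ (Tree A) λ r′ → graftAt ℓ ds r ≡ just r′ × u ≡ node l r′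
  graftAt-goR⁻ ℓ ds l r grafted with graftAt ℓ ds r
  graftAt-goR⁻ ℓ ds l r refl | just r′ = r′ , refl , refl

  ∈-graftAt⁻ : ∀ ℓ ds t {u a} → graftAt ℓ ds t ≡ just u → a ∈ leaves u → a ≡ ℓ ⊎ a ∈ leaves t
  ∈-graftAt⁻ ℓ [] t refl a∈u with ∈-++⁻ (leaves t) a∈u
  ... | inj₁ a∈t  = inj₂ a∈t
  ... | inj₂ a∈[ℓ] = inj₁ (singleton⁻ a∈[ℓ])
  ∈-graftAt⁻ ℓ (goL ∷ ds) (node l r) grafted a∈u with graftAt-goL⁻ ℓ ds l r grafted
  ... | l′ , grafted′ , refl with ∈-++⁻ (leaves l′) a∈u
  ...   | inj₂ a∈r = inj₂ (∈-++⁺ʳ (leaves l) a∈r)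
  ...   | inj₁ a∈l′ = Sum.map₂ ∈-++⁺ˡ (∈-graftAt⁻ ℓ ds l grafted′ a∈l′)
  ∈-graftAt⁻ ℓ (goR ∷ ds) (node l r) grafted a∈u with graftAt-goR⁻ ℓ ds l r grafted
  ... | r′ , grafted′ , refl with ∈-++⁻ (leaves l) a∈u
  ...   | inj₁ a∈l = inj₂ (∈-++⁺ˡ a∈l)
  ...   | inj₂ a∈r′ = Sum.map₂ (∈-++⁺ʳ (leaves l)) (∈-graftAt⁻ ℓ ds r grafted′ a∈r′)
  ∈-graftAt⁻ ℓ (goL ∷ ds) (leaf _) () a∈u
  ∈-graftAt⁻ ℓ (goR ∷ ds) (leaf _) () a∈u

  graftAt-∋ : ∀ ℓ ds t {u} → graftAt ℓ ds t ≡ just u → ℓ ∈ leaves u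
  graftAt-∋ ℓ [] t refl = ∈-++⁺ʳ (leaves t) (here refl)
  graftAt-∋ ℓ (goL ∷ ds) (node l r) grafted with graftAt-goL⁻ ℓ ds l r grafted
  ... | l′ , grafted′ , refl = ∈-++⁺ˡ (graftAt-∋ ℓ ds l grafted′)
  graftAt-∋ ℓ (goR ∷ ds) (node l r) grafted with graftAt-goR⁻ ℓ ds l r grafted
  ... | r′ , grafted′ , refl = ∈-++⁺ʳ (leaves l) (graftAt-∋ ℓ ds r grafted′)
  graftAt-∋ ℓ (goL ∷ ds) (leaf _) ()
  graftAt-∋ ℓ (goR ∷ ds) (leaf _) ()

  graftAt-distinct : ∀ ℓ ds t {u} → Distinct t → ℓ ∉ leaves t → graftAt ℓ ds t ≡ just u → Distinct u
  graftAt-distinct ℓ [] t dt ℓ∉t refl =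
    node dt leaf λ { (a∈t , here refl) → ℓ∉t a∈t }
  graftAt-distinct ℓ (goL ∷ ds) (node l r) (node dl dr l#r) ℓ∉t grafted with graftAt-goL⁻ ℓ ds l r grafted
  ... | l′ , grafted′ , refl =
    node (graftAt-distinct ℓ ds l dl (ℓ∉t ∘ ∈-++⁺ˡ) grafted′) dr l′#r
    where
    l′#r : Disjoint (leaves l′) (leaves r)
    l′#r (a∈l′ , a∈r) with ∈-graftAt⁻ ℓ ds l grafted′ a∈l′
    ... | inj₁ refl = ℓ∉t (∈-++⁺ʳ (leaves l) a∈r)
    ... | inj₂ a∈l  = l#r (a∈l , a∈r)
  graftAt-distinct ℓ (goR ∷ ds) (node l r) (node dl dr l#r) ℓ∉t grafted with graftAt-goR⁻ ℓ ds l r grafted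
  ... | r′ , grafted′ , refl =
    node dl (graftAt-distinct ℓ ds r dr (ℓ∉t ∘ ∈-++⁺ʳ (leaves l)) grafted′) l#r′
    where
    l#r′ : Disjoint (leaves l) (leaves r′)
    l#r′ (a∈l , a∈r′) with ∈-graftAt⁻ ℓ ds r grafted′ a∈r′
    ... | inj₁ refl = ℓ∉t (∈-++⁺ˡ a∈l)
    ... | inj₂ a∈r  = l#r (a∈l , a∈r)
  graftAt-distinct ℓ (goL ∷ ds) (leaf _) _ _ ()
  graftAt-distinct ℓ (goR ∷ ds) (leaf _) _ _ ()

  -- A graft into t₂ has a counterpart in any t₁ ≅ t₂ with an isomorphic
  -- result; a graft strictly below the root stays strictly below the root.
  mutual
    graftAt-≅ : ∀ ℓ {t₁ t₂ u₂} → t₁ ≅ t₂ → ∀ ds → graftAt ℓ ds t₂ ≡ just u₂ →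
                Σ (List Dir) λ ds′ → Σ (Tree A) λ u₁ → graftAt ℓ ds′ t₁ ≡ just u₁ × u₁ ≅ u₂
    graftAt-≅ ℓ t₁≅t₂ [] refl = [] , _ , refl , node≅ t₁≅t₂ leaf≅
    graftAt-≅ ℓ t₁≅t₂ (d ∷ ds) grafted with graftAt-≅⁺ ℓ t₁≅t₂ d ds grafted
    ... | d′ , ds′ , u₁ , grafted′ , u₁≅u₂ = d′ ∷ ds′ , u₁ , grafted′ , u₁≅u₂

    graftAt-≅⁺ : ∀ ℓ {t₁ t₂ u₂} → t₁ ≅ t₂ → ∀ d ds → graftAt ℓ (d ∷ ds) t₂ ≡ just u₂ →
                 Σ Dir λ d′ → Σ (List Dir) λ ds′ → Σ (Tree A) λ u₁ →
                   graftAt ℓ (d′ ∷ ds′) t₁ ≡ just u₁ × u₁ ≅ u₂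
    graftAt-≅⁺ ℓ leaf≅ goL ds ()
    graftAt-≅⁺ ℓ leaf≅ goR ds ()
    graftAt-≅⁺ ℓ {node l₁ r₁} {node l₂ r₂} (node≅ p q) goL ds grafted with graftAt-goL⁻ ℓ ds l₂ r₂ grafted
    ... | _ , grafted′ , refl with graftAt-≅ ℓ p ds grafted′
    ...   | ds′ , l₁′ , e , i = goL , ds′ , node l₁′ r₁ , cong (Maybe.map (λ x → node x r₁)) e , node≅ i q
    graftAt-≅⁺ ℓ {node l₁ r₁} {node l₂ r₂} (node≅ p q) goR ds grafted with graftAt-goR⁻ ℓ ds l₂ r₂ grafted
    ... | _ , grafted′ , refl with graftAt-≅ ℓ q ds grafted′
    ...   | ds′ , r₁′ , e , i = goR , ds′ , node l₁ r₁′ , cong (Maybe.map (λ x → node l₁ x)) e , node≅ p i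
    graftAt-≅⁺ ℓ {node l₁ r₁} {node l₂ r₂} (swap≅ p q) goL ds grafted with graftAt-goL⁻ ℓ ds l₂ r₂ grafted
    ... | _ , grafted′ , refl with graftAt-≅ ℓ q ds grafted′
    ...   | ds′ , r₁′ , e , i = goR , ds′ , node l₁ r₁′ , cong (Maybe.map (λ x → node l₁ x)) e , swap≅ p i
    graftAt-≅⁺ ℓ {node l₁ r₁} {node l₂ r₂} (swap≅ p q) goR ds grafted with graftAt-goR⁻ ℓ ds l₂ r₂ grafted
    ... | _ , grafted′ , refl with graftAt-≅ ℓ p ds grafted′
    ...   | ds′ , l₁′ , e , i = goL , ds′ , node l₁′ r₁ , cong (Maybe.map (λ x → node x r₁)) e , swap≅ i q

  graft-∋ : ∀ ℓ p m {u} → graft ℓ p m ≡ just u → ℓ ∈ leaves u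
  graft-∋ ℓ aboveRoot     nothing  refl    = here refl
  graft-∋ ℓ aboveRoot     (just t) grafted = graftAt-∋ ℓ [] t grafted
  graft-∋ ℓ (onEdge d ds) (just t) grafted = graftAt-∋ ℓ (d ∷ ds) t grafted

  graft-distinct : ∀ ℓ p m {u} → Distinctᵐ m → ℓ ∉ leavesᵐ m → graft ℓ p m ≡ just u → Distinct u
  graft-distinct ℓ aboveRoot     nothing  _  _   refl    = leaf
  graft-distinct ℓ aboveRoot     (just t) dt ℓ∉t grafted = graftAt-distinct ℓ [] t dt ℓ∉t grafted
  graft-distinct ℓ (onEdge d ds) (just t) dt ℓ∉t grafted = graftAt-distinct ℓ (d ∷ ds) t dt ℓ∉t grafted

  graft-≅ : ∀ ℓ {m₁ m₂ u₂} → m₁ ≅ᵐ m₂ → ∀ p → graft ℓ p m₂ ≡ just u₂ →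
            Σ Pos λ p′ → Σ (Tree A) λ u₁ → graft ℓ p′ m₁ ≡ just u₁ × u₁ ≅ u₂
  graft-≅ ℓ nothing≅  aboveRoot refl = aboveRoot , leaf ℓ , refl , leaf≅
  graft-≅ ℓ (just≅ i) aboveRoot refl = aboveRoot , _ , refl , node≅ i leaf≅
  graft-≅ ℓ (just≅ i) (onEdge d ds) grafted with graftAt-≅⁺ ℓ i d ds grafted
  ... | d′ , ds′ , u₁ , grafted′ , u₁≅u₂ = onEdge d′ ds′ , u₁ , grafted′ , u₁≅u₂

  map-nodeˡ-≅ : ∀ {m l} (r : Tree A) → m ≅ᵐ just l → Maybe.map (λ x → node x r) m ≅ᵐ just (node l r)
  map-nodeˡ-≅ r (just≅ i) = just≅ (node≅ i ≅-refl)

  map-nodeʳ-≅ : ∀ {m r} (l : Tree A) → m ≅ᵐ just r → Maybe.map (λ x → node l x) m ≅ᵐ just (node l r)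
  map-nodeʳ-≅ l (just≅ i) = just≅ (node≅ ≅-refl i)

  above : A → Maybe (Tree A) → Tree A
  above x nothing  = leaf x
  above x (just s) = node s (leaf x)

  graft-aboveRoot : ∀ x m → graft x aboveRoot m ≡ just (above x m)
  graft-aboveRoot x nothing  = refl
  graft-aboveRoot x (just s) = refl

  nodeᵐ-leaf : ∀ x m → nodeᵐ m (just (leaf x)) ≡ just (above x m)
  nodeᵐ-leaf x nothing  = refl
  nodeᵐ-leaf x (just s) = refl

  ∈-above : ∀ {a} x m → a ∈ leavesᵐ m → a ∈ leaves (above x m)
  ∈-above x (just s) a∈s = ∈-++⁺ˡ a∈s

  above-cong : ∀ x {m₁ m₂} → m₁ ≅ᵐ m₂ → above x m₁ ≅ above x m₂
  above-cong x nothing≅  = leaf≅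
  above-cong x (just≅ i) = node≅ i leaf≅

  stack : Maybe (Tree A) → List A → Maybe (Tree A)
  stack m []       = m
  stack m (x ∷ xs) = stack (just (above x m)) xs

  stack-cong : ∀ D {m₁ m₂} → m₁ ≅ᵐ m₂ → stack m₁ D ≅ᵐ stack m₂ D
  stack-cong []      m₁≅m₂ = m₁≅m₂
  stack-cong (x ∷ D) m₁≅m₂ = stack-cong D (just≅ (above-cong x m₁≅m₂))

  stack-tree : ∀ s D → Σ (Tree A) λ c → stack (just s) D ≡ just c
  stack-tree s []      = s , refl
  stack-tree s (x ∷ D) = stack-tree (node s (leaf x)) D

module _ {A : Set} (_≟_ : DecidableEquality A) where
  open WithDecEq _≟_
  open import Data.List.Membership.DecPropositional _≟_ using (_∈?_)

  removeLeaves-node : ∀ L l r → removeLeaves L (node l r) ≡ nodeᵐ (removeLeaves L l) (removeLeaves L r)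
  removeLeaves-node L l r with removeLeaves L l | removeLeaves L r
  ... | nothing | nothing = refl
  ... | just x  | nothing = refl
  ... | nothing | just y  = refl
  ... | just x  | just y  = refl

  removeLeaves-∈ : ∀ {a L} → a ∈ L → removeLeaves L (leaf a) ≡ nothing
  removeLeaves-∈ {a} {L} a∈L with a ∈? L
  ... | yes _   = refl
  ... | no  a∉L = ⊥-elim (a∉L a∈L)

  removeLeaves-∉ : ∀ {a L} → a ∉ L → removeLeaves L (leaf a) ≡ just (leaf a)
  removeLeaves-∉ {a} {L} a∉L with a ∈? L
  ... | yes a∈L = ⊥-elim (a∉L a∈L)
  ... | no _    = refl

  removeLeaves-cong : ∀ L {t u} → t ≅ u → removeLeaves L t ≅ᵐ removeLeaves L u
  removeLeaves-cong L leaf≅ = ≅ᵐ-refl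
  removeLeaves-cong L {node l r} {node l′ r′} (node≅ p q)
    rewrite removeLeaves-node L l r | removeLeaves-node L l′ r′ =
      nodeᵐ-cong (removeLeaves-cong L p) (removeLeaves-cong L q)
  removeLeaves-cong L {node l r} {node l′ r′} (swap≅ p q)
    rewrite removeLeaves-node L l r | removeLeaves-node L l′ r′ =
      nodeᵐ-swap (removeLeaves-cong L p) (removeLeaves-cong L q)

  ∈-removeLeaves⁻ : ∀ L t {a} → a ∈ leavesᵐ (removeLeaves L t) → a ∈ leaves t × a ∉ L
  ∈-removeLeaves⁻ L (leaf b) a∈ with b ∈? L
  ∈-removeLeaves⁻ L (leaf b) () | yes _
  ∈-removeLeaves⁻ L (leaf b) a∈ | no b∉L = a∈ , λ a∈L → b∉L (subst (_∈ L) (singleton⁻ a∈) a∈L)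
  ∈-removeLeaves⁻ L (node l r) a∈ rewrite removeLeaves-node L l r
    with ∈-nodeᵐ⁻ (removeLeaves L l) (removeLeaves L r) a∈
  ... | inj₁ a∈l = Product.map₁ ∈-++⁺ˡ (∈-removeLeaves⁻ L l a∈l)
  ... | inj₂ a∈r = Product.map₁ (∈-++⁺ʳ (leaves l)) (∈-removeLeaves⁻ L r a∈r)

  ∈-removeLeaves⁺ : ∀ L t {a} → a ∈ leaves t → a ∉ L → a ∈ leavesᵐ (removeLeaves L t)
  ∈-removeLeaves⁺ L (leaf b) (here refl) b∉L rewrite removeLeaves-∉ b∉L = here refl
  ∈-removeLeaves⁺ L (node l r) a∈ a∉L rewrite removeLeaves-node L l r with ∈-++⁻ (leaves l) a∈
  ... | inj₁ a∈l = ∈-nodeᵐ⁺ˡ (removeLeaves L l) (removeLeaves L r) (∈-removeLeaves⁺ L l a∈l a∉L)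
  ... | inj₂ a∈r = ∈-nodeᵐ⁺ʳ (removeLeaves L l) (removeLeaves L r) (∈-removeLeaves⁺ L r a∈r a∉L)

  removeLeaves-distinct : ∀ L {t} → Distinct t → Distinctᵐ (removeLeaves L t)
  removeLeaves-distinct L {leaf a} leaf with a ∈? L
  ... | yes _ = tt
  ... | no _  = leaf
  removeLeaves-distinct L {node l r} (node dl dr l#r) rewrite removeLeaves-node L l r =
    nodeᵐ-distinct (removeLeaves-distinct L dl) (removeLeaves-distinct L dr)
      λ (a∈l , a∈r) → l#r (proj₁ (∈-removeLeaves⁻ L l a∈l) , proj₁ (∈-removeLeaves⁻ L r a∈r))

  removeLeaves-disjoint : ∀ L t → Disjoint (leaves t) L → removeLeaves L t ≡ just t
  removeLeaves-disjoint L (leaf a) a#L = removeLeaves-∉ λ a∈L → a#L (here refl , a∈L)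
  removeLeaves-disjoint L (node l r) t#L
    rewrite removeLeaves-node L l r
          | removeLeaves-disjoint L l (λ (a∈l , a∈L) → t#L (∈-++⁺ˡ a∈l , a∈L))
          | removeLeaves-disjoint L r (λ (a∈r , a∈L) → t#L (∈-++⁺ʳ (leaves l) a∈r , a∈L)) = refl

  removeLeaves-ext : ∀ {L L′} → L ⊆ L′ → L′ ⊆ L → ∀ t → removeLeaves L t ≡ removeLeaves L′ t
  removeLeaves-ext {L} L⊆L′ L′⊆L (leaf a) with a ∈? L
  ... | yes a∈L = sym (removeLeaves-∈ (L⊆L′ a∈L))
  ... | no  a∉L = sym (removeLeaves-∉ (a∉L ∘ L′⊆L))
  removeLeaves-ext {L} {L′} L⊆L′ L′⊆L (node l r)
    rewrite removeLeaves-node L l r | removeLeaves-node L′ l r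
          | removeLeaves-ext L⊆L′ L′⊆L l | removeLeaves-ext L⊆L′ L′⊆L r = refl

  nodeᵐ->>= : ∀ M m₁ m₂ →
              (nodeᵐ m₁ m₂ >>= removeLeaves M) ≡ nodeᵐ (m₁ >>= removeLeaves M) (m₂ >>= removeLeaves M)
  nodeᵐ->>= M nothing  nothing  = refl
  nodeᵐ->>= M (just x) nothing  = sym (nodeᵐ-nothingʳ (removeLeaves M x))
  nodeᵐ->>= M nothing  (just y) = sym (nodeᵐ-nothingˡ (removeLeaves M y))
  nodeᵐ->>= M (just x) (just y) = removeLeaves-node M x y

  removeLeaves-++ : ∀ L M t → (removeLeaves L t >>= removeLeaves M) ≡ removeLeaves (L ++ M) t
  removeLeaves-++ L M (leaf a) with a ∈? L
  ... | yes a∈L = sym (removeLeaves-∈ (∈-++⁺ˡ a∈L))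
  ... | no  a∉L with a ∈? M
  ...   | yes a∈M = sym (removeLeaves-∈ (∈-++⁺ʳ L a∈M))
  ...   | no  a∉M = sym (removeLeaves-∉ ([ a∉L , a∉M ]′ ∘ ∈-++⁻ L))
  removeLeaves-++ L M (node l r)
    rewrite removeLeaves-node L l r | removeLeaves-node (L ++ M) l r
          | nodeᵐ->>= M (removeLeaves L l) (removeLeaves L r)
          | removeLeaves-++ L M l | removeLeaves-++ L M r = refl

  removeLeaves-absorb : ∀ {ℓ X} → ℓ ∈ X → ∀ t →
                        (removeLeaves [ ℓ ] t >>= removeLeaves X) ≡ removeLeaves X t
  removeLeaves-absorb {ℓ} {X} ℓ∈X t = trans (removeLeaves-++ [ ℓ ] X t) (removeLeaves-ext absorb there t)
    where
    absorb : ℓ ∷ X ⊆ X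
    absorb (here refl) = ℓ∈X
    absorb (there a∈X) = a∈X

  graftAt-removeLeaves : ∀ {ℓ X} ds t {u} → ℓ ∈ X → graftAt ℓ ds t ≡ just u →
                         removeLeaves X u ≡ removeLeaves X t
  graftAt-removeLeaves {ℓ} {X} [] t ℓ∈X refl
    rewrite removeLeaves-node X t (leaf ℓ) | removeLeaves-∈ ℓ∈X = nodeᵐ-nothingʳ (removeLeaves X t)
  graftAt-removeLeaves {ℓ} {X} (goL ∷ ds) (node l r) ℓ∈X grafted with graftAt-goL⁻ ℓ ds l r grafted
  ... | l′ , grafted′ , refl
    rewrite removeLeaves-node X l′ r | removeLeaves-node X l r | graftAt-removeLeaves ds l ℓ∈X grafted′ = refl
  graftAt-removeLeaves {ℓ} {X} (goR ∷ ds) (node l r) ℓ∈X grafted with graftAt-goR⁻ ℓ ds l r grafted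
  ... | r′ , grafted′ , refl
    rewrite removeLeaves-node X l r′ | removeLeaves-node X l r | graftAt-removeLeaves ds r ℓ∈X grafted′ = refl
  graftAt-removeLeaves (goL ∷ ds) (leaf _) ℓ∈X ()
  graftAt-removeLeaves (goR ∷ ds) (leaf _) ℓ∈X ()

  graft-removeLeaves : ∀ {ℓ X} p m {u} → ℓ ∈ X → graft ℓ p m ≡ just u →
                       removeLeaves X u ≡ (m >>= removeLeaves X)
  graft-removeLeaves aboveRoot     nothing  ℓ∈X refl    = removeLeaves-∈ ℓ∈X
  graft-removeLeaves aboveRoot     (just t) ℓ∈X grafted = graftAt-removeLeaves [] t ℓ∈X grafted
  graft-removeLeaves (onEdge d ds) (just t) ℓ∈X grafted = graftAt-removeLeaves (d ∷ ds) t ℓ∈X grafted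

  applyMove⁻ : ∀ t {ℓ p u} → applyMove t (ℓ , p) ≡ just u →
               ℓ ∈ leaves t × graft ℓ p (removeLeaves [ ℓ ] t) ≡ just u
  applyMove⁻ t {ℓ} moved with ℓ ∈? leaves t
  applyMove⁻ t moved | yes ℓ∈t = ℓ∈t , moved
  applyMove⁻ t ()    | no _

  applyMove-valid : ∀ t ℓ p → ℓ ∈ leaves t → applyMove t (ℓ , p) ≡ graft ℓ p (removeLeaves [ ℓ ] t)
  applyMove-valid t ℓ p ℓ∈t with ℓ ∈? leaves t
  ... | yes _   = refl
  ... | no ℓ∉t = ⊥-elim (ℓ∉t ℓ∈t)

  applySeq-∷ : ∀ t m ms {t′} → applyMove t m ≡ just t′ → applySeq t (m ∷ ms) ≡ applySeq t′ ms
  applySeq-∷ t m ms moved rewrite moved = refl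

  applySeq-single : ∀ t m → applySeq t [ m ] ≡ applyMove t m
  applySeq-single t m with applyMove t m
  ... | nothing = refl
  ... | just _  = refl

  applySeq-++ : ∀ t ms ns {t′} → applySeq t ms ≡ just t′ → applySeq t (ms ++ ns) ≡ applySeq t′ ns
  applySeq-++ t []       ns refl = refl
  applySeq-++ t (m ∷ ms) ns run with applyMove t m
  applySeq-++ t (m ∷ ms) ns run | just t₁ = applySeq-++ t₁ ms ns run
  applySeq-++ t (m ∷ ms) ns ()  | nothing

  applyMove-removeLeaves : ∀ X t {ℓ p u} → ℓ ∈ X → applyMove t (ℓ , p) ≡ just u →
                           removeLeaves X u ≡ removeLeaves X t
  applyMove-removeLeaves X t {ℓ} {p} ℓ∈X moved =
    trans (graft-removeLeaves p (removeLeaves [ ℓ ] t) ℓ∈X (proj₂ (applyMove⁻ t moved)))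
          (removeLeaves-absorb ℓ∈X t)

  applySeq-removeLeaves : ∀ X t ms {u} → map proj₁ ms ⊆ X → applySeq t ms ≡ just u →
                          removeLeaves X u ≡ removeLeaves X t
  applySeq-removeLeaves X t []             _      refl = refl
  applySeq-removeLeaves X t ((ℓ , p) ∷ ms) ms⊆X   run with applyMove t (ℓ , p) in moved
  applySeq-removeLeaves X t ((ℓ , p) ∷ ms) ms⊆X run | just t′ =
    trans (applySeq-removeLeaves X t′ ms (ms⊆X ∘ there) run) (applyMove-removeLeaves X t (ms⊆X (here refl)) moved)
  applySeq-removeLeaves X t ((ℓ , p) ∷ ms) ms⊆X () | nothing

  turnsInto⇒removeLeaves≅ : ∀ X T₁ T₂ ms → TurnsInto T₁ ms T₂ → map proj₁ ms ⊆ X →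
                            removeLeaves X T₁ ≅ᵐ removeLeaves X T₂
  turnsInto⇒removeLeaves≅ X T₁ T₂ ms turns ms⊆X with ≅ᵐ-just⁻ (applySeq T₁ ms) turns
  ... | u , run , u≅T₂ =
    subst (_≅ᵐ removeLeaves X T₂) (applySeq-removeLeaves X T₁ ms ms⊆X run) (removeLeaves-cong X u≅T₂)

  applyMove-≅ : ∀ {t₁ t₂ u₂} ℓ p → t₁ ≅ t₂ → applyMove t₂ (ℓ , p) ≡ just u₂ →
                Σ Pos λ p′ → Σ (Tree A) λ u₁ → applyMove t₁ (ℓ , p′) ≡ just u₁ × u₁ ≅ u₂
  applyMove-≅ {t₁} {t₂} ℓ p t₁≅t₂ moved with applyMove⁻ t₂ moved
  ... | ℓ∈t₂ , grafted with graft-≅ ℓ (removeLeaves-cong [ ℓ ] t₁≅t₂) p grafted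
  ...   | p′ , u₁ , grafted′ , u₁≅u₂ =
    p′ , u₁ , trans (applyMove-valid t₁ ℓ p′ (∈-≅ (≅-sym t₁≅t₂) ℓ∈t₂)) grafted′ , u₁≅u₂

  applySeq-≅ : ∀ {t₁ t₂ V} ms → t₁ ≅ t₂ → applySeq t₂ ms ≅ᵐ just V →
               Σ (List (LPRMove A)) λ ms′ → applySeq t₁ ms′ ≅ᵐ just V × map proj₁ ms′ ≡ map proj₁ ms
  applySeq-≅ [] t₁≅t₂ turns = [] , ≅ᵐ-trans (just≅ t₁≅t₂) turns , refl
  applySeq-≅ {t₁} {t₂} {V} ((ℓ , p) ∷ ms) t₁≅t₂ turns with applyMove t₂ (ℓ , p) in moved
  applySeq-≅ {t₁} {t₂} {V} ((ℓ , p) ∷ ms) t₁≅t₂ turns | just t₂′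
    with applyMove-≅ ℓ p t₁≅t₂ moved
  ... | p′ , t₁′ , moved′ , t₁′≅t₂′ with applySeq-≅ ms t₁′≅t₂′ turns
  ...   | ms′ , turns′ , same =
    (ℓ , p′) ∷ ms′ , subst (_≅ᵐ just V) (sym (applySeq-∷ t₁ (ℓ , p′) ms′ moved′)) turns′ , cong (ℓ ∷_) same
  applySeq-≅ ((ℓ , p) ∷ ms) t₁≅t₂ () | nothing

  Reach : Tree A → Tree A → List A → Set
  Reach U V L = Σ (List (LPRMove A)) λ ms → applySeq U ms ≅ᵐ just V × map proj₁ ms ⊆ L

  reach-refl : ∀ {U L} → Reach U U L
  reach-refl = [] , just≅ ≅-refl , λ ()

  reach-mono : ∀ {U V L L′} → L ⊆ L′ → Reach U V L → Reach U V L′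
  reach-mono L⊆L′ (ms , turns , ms⊆L) = ms , turns , L⊆L′ ∘ ms⊆L

  reach-≅ : ∀ {t₁ t₂ V L} → t₁ ≅ t₂ → Reach t₂ V L → Reach t₁ V L
  reach-≅ t₁≅t₂ (ms , turns , ms⊆L) with applySeq-≅ ms t₁≅t₂ turns
  ... | ms′ , turns′ , same = ms′ , turns′ , λ {a} a∈ms′ → ms⊆L (subst (a ∈_) same a∈ms′)

  reach-trans : ∀ {U W V L} → Reach U W L → Reach W V L → Reach U V L
  reach-trans {U} {W} {V} {L} (ms₁ , turns₁ , ms₁⊆L) W⇝V with ≅ᵐ-just⁻ (applySeq U ms₁) turns₁
  ... | W′ , run₁ , W′≅W with reach-≅ W′≅W W⇝V
  ...   | ms₂ , turns₂ , ms₂⊆L =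
    ms₁ ++ ms₂ , subst (_≅ᵐ just V) (sym (applySeq-++ U ms₁ ms₂ run₁)) turns₂ , ms⊆L
    where
    ms⊆L : map proj₁ (ms₁ ++ ms₂) ⊆ L
    ms⊆L a∈ rewrite map-++ proj₁ ms₁ ms₂ = [ ms₁⊆L , ms₂⊆L ]′ (∈-++⁻ (map proj₁ ms₁) a∈)

  removeLeaves-nodeˡ : ∀ {ℓ} l r → ℓ ∈ leaves l → Disjoint (leaves l) (leaves r) →
                       removeLeaves [ ℓ ] (node l r) ≡ nodeᵐ (removeLeaves [ ℓ ] l) (just r)
  removeLeaves-nodeˡ {ℓ} l r ℓ∈l l#r = trans (removeLeaves-node [ ℓ ] l r) (cong (nodeᵐ _) r-kept)
    where
    r-kept : removeLeaves [ ℓ ] r ≡ just r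
    r-kept = removeLeaves-disjoint [ ℓ ] r λ (a∈r , a∈[ℓ]) →
               l#r (subst (_∈ leaves l) (sym (singleton⁻ a∈[ℓ])) ℓ∈l , a∈r)

  removeLeaves-nodeʳ : ∀ {ℓ} l r → ℓ ∈ leaves r → Disjoint (leaves l) (leaves r) →
                       removeLeaves [ ℓ ] (node l r) ≡ nodeᵐ (just l) (removeLeaves [ ℓ ] r)
  removeLeaves-nodeʳ {ℓ} l r ℓ∈r l#r = trans (removeLeaves-node [ ℓ ] l r) (cong (λ m → nodeᵐ m _) l-kept)
    where
    l-kept : removeLeaves [ ℓ ] l ≡ just l
    l-kept = removeLeaves-disjoint [ ℓ ] l λ (a∈l , a∈[ℓ]) →
               l#r (a∈l , subst (_∈ leaves r) (sym (singleton⁻ a∈[ℓ])) ℓ∈r)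

  locate : ∀ ℓ t → Distinct t → ℓ ∈ leaves t →
           t ≡ leaf ℓ ⊎ Σ (Tree A) λ t′ → Σ (List Dir) λ ds →
             removeLeaves [ ℓ ] t ≡ just t′ × graftAt ℓ ds t′ ≅ᵐ just t
  locate ℓ (leaf a) leaf (here refl) = inj₁ refl
  locate ℓ (node l r) (node dl dr l#r) ℓ∈t with ∈-++⁻ (leaves l) ℓ∈t
  ... | inj₁ ℓ∈l with locate ℓ l dl ℓ∈l
  ...   | inj₁ refl = inj₂ (r , [] , removed , just≅ (swap≅ ≅-refl leaf≅))
    where
    removed : removeLeaves [ ℓ ] (node (leaf ℓ) r) ≡ just r
    removed = trans (removeLeaves-nodeˡ (leaf ℓ) r ℓ∈l l#r)
                    (cong (λ m → nodeᵐ m (just r)) (removeLeaves-∈ (here refl)))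
  ...   | inj₂ (l′ , ds , removed , regrafted) =
    inj₂ (node l′ r , goL ∷ ds , trans (removeLeaves-nodeˡ l r ℓ∈l l#r) (cong (λ m → nodeᵐ m (just r)) removed) ,
          map-nodeˡ-≅ r regrafted)
  locate ℓ (node l r) (node dl dr l#r) ℓ∈t | inj₂ ℓ∈r with locate ℓ r dr ℓ∈r
  ...   | inj₁ refl = inj₂ (l , [] , removed , ≅ᵐ-refl)
    where
    removed : removeLeaves [ ℓ ] (node l (leaf ℓ)) ≡ just l
    removed = trans (removeLeaves-nodeʳ l (leaf ℓ) ℓ∈r l#r) (cong (nodeᵐ (just l)) (removeLeaves-∈ (here refl)))
  ...   | inj₂ (r′ , ds , removed , regrafted) =
    inj₂ (node l r′ , goR ∷ ds , trans (removeLeaves-nodeʳ l r ℓ∈r l#r) (cong (nodeᵐ (just l)) removed) ,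
          map-nodeʳ-≅ l regrafted)

  regraft-position : ∀ ℓ t → Distinct t → ℓ ∈ leaves t →
                     Σ Pos λ p → graft ℓ p (removeLeaves [ ℓ ] t) ≅ᵐ just t
  regraft-position ℓ t dt ℓ∈t with locate ℓ t dt ℓ∈t
  ... | inj₁ refl rewrite removeLeaves-∈ {ℓ} {[ ℓ ]} (here refl) = aboveRoot , just≅ leaf≅
  ... | inj₂ (t′ , [] , removed , regrafted)     rewrite removed = aboveRoot , regrafted
  ... | inj₂ (t′ , d ∷ ds , removed , regrafted) rewrite removed = onEdge d ds , regrafted

  applyMove-distinct : ∀ t {ℓ p u} → Distinct t → applyMove t (ℓ , p) ≡ just u → Distinct u
  applyMove-distinct t {ℓ} {p} dt moved =
    graft-distinct ℓ p (removeLeaves [ ℓ ] t) (removeLeaves-distinct [ ℓ ] dt)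
      (λ ℓ∈ → proj₂ (∈-removeLeaves⁻ [ ℓ ] t ℓ∈) (here refl)) (proj₂ (applyMove⁻ t moved))

  applyMove-invertible : ∀ t {ℓ p u} → Distinct t → applyMove t (ℓ , p) ≡ just u → Reach u t [ ℓ ]
  applyMove-invertible t {ℓ} {p} {u} dt moved with applyMove⁻ t moved
  ... | ℓ∈t , grafted with regraft-position ℓ t dt ℓ∈t
  ...   | p₀ , regrafted = [ (ℓ , p₀) ] , subst (_≅ᵐ just t) (sym undo) regrafted , id
    where
    open ≡-Reasoning
    undo : applySeq u [ (ℓ , p₀) ] ≡ graft ℓ p₀ (removeLeaves [ ℓ ] t)
    undo = begin
      applySeq u [ (ℓ , p₀) ]                  ≡⟨ applySeq-single u (ℓ , p₀) ⟩
      applyMove u (ℓ , p₀)                     ≡⟨ applyMove-valid u ℓ p₀ (graft-∋ ℓ p _ grafted) ⟩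
      graft ℓ p₀ (removeLeaves [ ℓ ] u)        ≡⟨ cong (graft ℓ p₀) (graft-removeLeaves p _ (here refl) grafted) ⟩
      graft ℓ p₀ (removeLeaves [ ℓ ] t >>= removeLeaves [ ℓ ])
                                               ≡⟨ cong (graft ℓ p₀) (removeLeaves-absorb (here refl) t) ⟩
      graft ℓ p₀ (removeLeaves [ ℓ ] t)        ∎

  applySeq-invertible : ∀ t ms {u} → Distinct t → applySeq t ms ≡ just u → Reach u t (map proj₁ ms)
  applySeq-invertible t [] dt refl = reach-refl
  applySeq-invertible t ((ℓ , p) ∷ ms) dt run with applyMove t (ℓ , p) in moved
  applySeq-invertible t ((ℓ , p) ∷ ms) dt run | just t′ =
    reach-trans (reach-mono there (applySeq-invertible t′ ms (applyMove-distinct t dt moved) run))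
                (reach-mono (here ∘ singleton⁻) (applyMove-invertible t dt moved))
  applySeq-invertible t ((ℓ , p) ∷ ms) dt () | nothing

  toRoot : List A → List (LPRMove A)
  toRoot = map (λ x → x , aboveRoot)

  labels-toRoot : ∀ D → map proj₁ (toRoot D) ≡ D
  labels-toRoot D = trans (sym (map-∘ D)) (map-id D)

  removeLeaves-above : ∀ {x L} m → x ∉ L → removeLeaves L (above x m) ≡ just (above x (m >>= removeLeaves L))
  removeLeaves-above nothing x∉L = removeLeaves-∉ x∉L
  removeLeaves-above {x} {L} (just t) x∉L
    rewrite removeLeaves-node L t (leaf x) | removeLeaves-∉ x∉L = nodeᵐ-leaf x (removeLeaves L t)

  toRoot-result : ∀ D t → Unique D → D ⊆ leaves t → applySeq t (toRoot D) ≡ stack (removeLeaves D t) D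
  toRoot-result [] t _ _ = sym (removeLeaves-disjoint [] t λ { (_ , ()) })
  toRoot-result (x ∷ xs) t (x≢xs ∷ u-xs) x∷xs⊆t = begin
      applySeq t ((x , aboveRoot) ∷ toRoot xs)
        ≡⟨ applySeq-∷ t _ (toRoot xs) moved ⟩
      applySeq t′ (toRoot xs)
        ≡⟨ toRoot-result xs t′ u-xs xs⊆t′ ⟩
      stack (removeLeaves xs t′) xs
        ≡⟨ cong (λ m → stack m xs) (removeLeaves-above (removeLeaves [ x ] t) x∉xs) ⟩
      stack (just (above x (removeLeaves [ x ] t >>= removeLeaves xs))) xs
        ≡⟨ cong (λ m → stack (just (above x m)) xs) (removeLeaves-++ [ x ] xs t) ⟩
      stack (removeLeaves (x ∷ xs) t) (x ∷ xs)
        ∎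
    where
    open ≡-Reasoning
    t′ : Tree A
    t′ = above x (removeLeaves [ x ] t)
    moved : applyMove t (x , aboveRoot) ≡ just t′
    moved = trans (applyMove-valid t x aboveRoot (x∷xs⊆t (here refl))) (graft-aboveRoot x _)
    x∉xs : x ∉ xs
    x∉xs = All¬⇒¬Any x≢xs
    xs⊆t′ : xs ⊆ leaves t′
    xs⊆t′ a∈xs = ∈-above x (removeLeaves [ x ] t) (∈-removeLeaves⁺ [ x ] t (x∷xs⊆t (there a∈xs))
                   λ a∈[x] → x∉xs (subst (_∈ xs) (singleton⁻ a∈[x]) a∈xs))

  stack-just : ∀ D t → Σ (Tree A) λ c → stack (removeLeaves D t) D ≡ just c
  stack-just []      t = t , removeLeaves-disjoint [] t λ { (_ , ()) }
  stack-just (x ∷ D) t = stack-tree (above x (removeLeaves (x ∷ D) t)) D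

  -- (⇒) for a duplicate-free list D: stack both trees, then run the
  -- reversal of T₂'s stacking, transported to the stack of T₁.
  turnsInto-via-root : ∀ D T₁ T₂ → Unique D → Distinct T₂ → D ⊆ leaves T₁ → D ⊆ leaves T₂ →
                       removeLeaves D T₁ ≅ᵐ removeLeaves D T₂ →
                       Σ (List (LPRMove A)) λ ms → TurnsInto T₁ ms T₂ × D ⊆ map proj₁ ms × map proj₁ ms ⊆ D
  turnsInto-via-root D T₁ T₂ u-D dT₂ D⊆T₁ D⊆T₂ same with stack-just D T₁ | stack-just D T₂
  ... | c₁ , stacked₁ | c₂ , stacked₂
    with reach-≅ (just-≅⁻ (subst₂ _≅ᵐ_ stacked₁ stacked₂ (stack-cong D same)))
                 (reach-mono (λ {a} → subst (a ∈_) (labels-toRoot D))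
                   (applySeq-invertible T₂ (toRoot D) dT₂ (trans (toRoot-result D T₂ u-D D⊆T₂) stacked₂)))
  ... | ms , turns , ms⊆D =
    toRoot D ++ ms , subst (_≅ᵐ just T₂) (sym (applySeq-++ T₁ (toRoot D) ms run₁)) turns ,
    (λ {a} a∈D → subst (a ∈_) (sym labels) (∈-++⁺ˡ a∈D)) ,
    (λ {a} a∈ → [ id , ms⊆D ]′ (∈-++⁻ D (subst (a ∈_) labels a∈)))
    where
    run₁ : applySeq T₁ (toRoot D) ≡ just c₁
    run₁ = trans (toRoot-result D T₁ u-D D⊆T₁) stacked₁
    labels : map proj₁ (toRoot D ++ ms) ≡ D ++ map proj₁ ms
    labels = trans (map-++ proj₁ (toRoot D) ms) (cong (_++ map proj₁ ms) (labels-toRoot D))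

  removeLeaves≅⇒turnsInto : ∀ X T₁ T₂ → Distinct T₂ → X ⊆ leaves T₁ → X ⊆ leaves T₂ →
                            removeLeaves X T₁ ≅ᵐ removeLeaves X T₂ →
                            Σ (List (LPRMove A)) λ ms → TurnsInto T₁ ms T₂ × (∀ a → (a ∈ X) ⇔ (a ∈ map proj₁ ms))
  removeLeaves≅⇒turnsInto X T₁ T₂ dT₂ X⊆T₁ X⊆T₂ same =
    let ms , turns , D⊆ms , ms⊆D =
          turnsInto-via-root D T₁ T₂ (deduplicate-! _≟_ X) dT₂ (X⊆T₁ ∘ D⊆X) (X⊆T₂ ∘ D⊆X)
            (subst₂ _≅ᵐ_ (removeLeaves-ext X⊆D D⊆X T₁) (removeLeaves-ext X⊆D D⊆X T₂) same)
    in ms , turns , λ a → mk⇔ (D⊆ms ∘ X⊆D) (D⊆X ∘ ms⊆D)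
    where
    D : List A
    D = deduplicate _≟_ X
    D⊆X : D ⊆ X
    D⊆X = ∈-deduplicate⁻ _≟_ X
    X⊆D : X ⊆ D
    X⊆D = ∈-deduplicate⁺ _≟_

lemma3 : {A : Set} (_≟_ : DecidableEquality A) (T₁ T₂ : Tree A) (X : List A) →
    Unique (leaves T₁) → Unique (leaves T₂) →
    (∀ a → (a ∈ leaves T₁) ⇔ (a ∈ leaves T₂)) →
    (∀ x → x ∈ X → x ∈ leaves T₁) →
    (WithDecEq.removeLeaves _≟_ X T₁ ≅ᵐ WithDecEq.removeLeaves _≟_ X T₂)
      ⇔ Σ (List (LPRMove A)) (λ ms →
          WithDecEq.TurnsInto _≟_ T₁ ms T₂ × (∀ a → (a ∈ X) ⇔ (a ∈ map proj₁ ms)))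
lemma3 _≟_ T₁ T₂ X _ unique₂ same-labels X⊆T₁ = mk⇔
  (removeLeaves≅⇒turnsInto _≟_ X T₁ T₂ (unique⇒distinct T₂ unique₂) (X⊆T₁ _) X⊆T₂)
  (λ { (ms , turns , moved-X) → turnsInto⇒removeLeaves≅ _≟_ X T₁ T₂ ms turns (Equivalence.from (moved-X _)) })
  where
  X⊆T₂ : X ⊆ leaves T₂
  X⊆T₂ x∈X = Equivalence.to (same-labels _) (X⊆T₁ _ x∈X)
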